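{- Let $X$ be a finite connected vertex-transitive graph with at least $3$ vertices, and let $G$ be a group of automorphisms of $X$ acting transitively on $V(X)$ such that $G'$ is cyclic of order $p^k$ for a prime $p$, and such that $X$ is $G$-minimal. If for each $x \in V(X)$ the subgraph of $X$ induced by the $G'$-orbit $G'x$ has at least one edge, then each of these induced subgraphs is connected and $p$ is odd.
   Context: $G'$ is the commutator subgroup of $G$, and $G'x=\{gx : g\in G'\}$. $X$ is $G$-minimal if every connected spanning subgraph $Y$ of $X$ with $gY=Y$ for all $g\in G$ equals $X$. -}

module Defs where

open import Level using (0ℓ)
open import Data.Nat using (ℕ; zero; suc; _<_; _≤_; _^_)
open import Data.Nat.Divisibility using (_∣_)
open import Data.Nat.Primality using (Prime)
open import Data.Fin using (Fin)
open import Data.Fin.Permutation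
  using (Permutation′; _⟨$⟩ʳ_; _≈_; id; flip; _∘ₚ_)
open import Data.Product using (Σ; _×_; ∃; ∃-syntax)
open import Relation.Binary.Core using (Rel)
open import Relation.Binary.Construct.Closure.ReflexiveTransitive using (Star)
open import Relation.Binary.PropositionalEquality using (_≡_)
open import Relation.Nullary using (¬_)

record Graph (n : ℕ) : Set₁ where
  field
    E       : Rel (Fin n) 0ℓ
    sym     : ∀ {x y} → E x y → E y x
    irrefl  : ∀ {x} → ¬ E x x
open Graph public

Connected : ∀ {n} → Graph n → Set
Connected X = ∀ x y → Star (E X) x y

IsAut : ∀ {n} → Graph n → Permutation′ n → Set
IsAut X σ = ∀ x y → (E X x y → E X (σ ⟨$⟩ʳ x) (σ ⟨$⟩ʳ y))
                   × (E X (σ ⟨$⟩ʳ x) (σ ⟨$⟩ʳ y) → E X x y)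

VertexTransitive : ∀ {n} → Graph n → Set
VertexTransitive {n} X = ∀ (x y : Fin n) → ∃[ σ ] (IsAut X σ × (σ ⟨$⟩ʳ x ≡ y))

-- A group G of automorphisms of X, given as a subset of the permutations.
-- σ ∘ₚ τ means "first σ, then τ".
record AutGroup {n} (X : Graph n) : Set₁ where
  field
    mem   : Permutation′ n → Set
    resp  : ∀ {σ τ} → σ ≈ τ → mem σ → mem τ
    idG   : mem id
    mulG  : ∀ {σ τ} → mem σ → mem τ → mem (σ ∘ₚ τ)
    invG  : ∀ {σ} → mem σ → mem (flip σ)
    aut   : ∀ {σ} → mem σ → IsAut X σ
open AutGroup public

Transitive : ∀ {n} {X : Graph n} → AutGroup X → Set
Transitive {n} G = ∀ (x y : Fin n) → ∃[ σ ] (mem G σ × (σ ⟨$⟩ʳ x ≡ y))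

commutator : ∀ {n} → Permutation′ n → Permutation′ n → Permutation′ n
commutator g h = ((flip g ∘ₚ flip h) ∘ₚ g) ∘ₚ h

data _∈Comm[_] {n} {X : Graph n} : Permutation′ n → AutGroup X → Set₁ where
  c-resp : ∀ {G σ τ} → σ ≈ τ → σ ∈Comm[ G ] → τ ∈Comm[ G ]
  c-id   : ∀ {G} → id ∈Comm[ G ]
  c-comm : ∀ {G g h} → mem G g → mem G h → commutator g h ∈Comm[ G ]
  c-mul  : ∀ {G σ τ} → σ ∈Comm[ G ] → τ ∈Comm[ G ] → (σ ∘ₚ τ) ∈Comm[ G ]
  c-inv  : ∀ {G σ} → σ ∈Comm[ G ] → flip σ ∈Comm[ G ]

_^ₚ_ : ∀ {n} → Permutation′ n → ℕ → Permutation′ n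
c ^ₚ zero  = id
c ^ₚ suc i = c ∘ₚ (c ^ₚ i)

CommCyclicOfOrder : ∀ {n} {X : Graph n} → AutGroup X → ℕ → Set₁
CommCyclicOfOrder {n} G m =
  Σ (Permutation′ n) λ c →
    (c ∈Comm[ G ])
    × (∀ σ → σ ∈Comm[ G ] → ∃[ i ] (i < m × σ ≈ (c ^ₚ i)))
    × (∀ i j → i < m → j < m → (c ^ₚ i) ≈ (c ^ₚ j) → i ≡ j)

SpanningSub : ∀ {n} → Graph n → Graph n → Set
SpanningSub Y X = ∀ x y → E Y x y → E X x y

GInvariant : ∀ {n} {X : Graph n} → AutGroup X → Graph n → Set
GInvariant {n} G Y = ∀ g → mem G g → ∀ (x y : Fin n) →
  (E Y x y → E Y (g ⟨$⟩ʳ x) (g ⟨$⟩ʳ y)) × (E Y (g ⟨$⟩ʳ x) (g ⟨$⟩ʳ y) → E Y x y)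

GMinimal : ∀ {n} (X : Graph n) → AutGroup X → Set₁
GMinimal {n} X G = (Y : Graph n) → SpanningSub Y X → Connected Y → GInvariant G Y →
  ∀ x y → E X x y → E Y x y

InOrbit : ∀ {n} {X : Graph n} → AutGroup X → Fin n → Fin n → Set₁
InOrbit G x y = ∃[ c ] (c ∈Comm[ G ] × c ⟨$⟩ʳ x ≡ y)

record InducedEdge {n} (X : Graph n) (G : AutGroup X) (x y z : Fin n) : Set₁ where
  constructor ind-edge
  field
    inY : InOrbit G x y
    inZ : InOrbit G x z
    edge : E X y z

OrbitHasEdge : ∀ {n} (X : Graph n) (G : AutGroup X) → Fin n → Set₁
OrbitHasEdge X G x = ∃[ y ] ∃[ z ] InducedEdge X G x y z

OrbitConnected : ∀ {n} (X : Graph n) (G : AutGroup X) → Fin n → Set₁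
OrbitConnected X G x = ∀ y z → InOrbit G x y → InOrbit G x z →
  Star (InducedEdge X G x) y z

Odd : ℕ → Set
Odd p = ¬ (2 ∣ p)

-- G′ = ⟨c⟩ is normal in G, so every g ∈ G conjugates c to a power c^u with u a unit
-- modulo N = |G′|. Hence, for a set P of exponents stable under multiplication by units,
-- deleting from X the edges {v, c^t v} with t ∈ P leaves a G-invariant spanning subgraph Y,
-- which by G-minimality is X itself unless it is disconnected. Walking along X from x₀
-- and absorbing deleted edges into the exponent, every vertex z has some c^j z in the
-- Y-component of x₀; if moreover x₀ is Y-joined to c^a x₀ with a a unit, then conjugation
-- and Bézout join every w to c w, and Y is connected.
--
-- For P = pℕ this applies with a = j + 1 where x₀ ⇝ c^j (c x₀), p ∣ j. So no edge of X
-- joins v to c^(pt) v: an edge of X[G′x] joins v to c^t v with p ∤ t, and since c^t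
-- generates G′ its translates connect the orbit. If p = 2, take P = odd numbers: the
-- orbit edges are deleted, so Y is disconnected and every Y-walk x₀ ⇝ c^i x₀ has i even.
-- Then g ↦ parity of j with x₀ ⇝ c^j (g x₀) is a homomorphism G → ℤ/2, which vanishes
-- on G′ but not on c.

module Submission where

open import Level using (0ℓ)
open import Function using (_∘_)
open import Data.Nat using (ℕ; zero; suc; _<_; _≤_; _^_; _+_; _*_; _∸_; _%_; _/_; NonZero; s≤s; z≤n; >-nonZero⁻¹; parity)
open import Data.Nat.Properties
  using (1+n≢n; ≤-trans; +-comm; +-assoc; *-comm; *-suc; suc-pred; m∸n+n≡m; m∸n≡0⇒m≤n; <⇒≱; ∸-monoʳ-<; <⇒≤; m^n≢0)
open import Data.Nat.Divisibility
open import Data.Nat.DivMod using (m≡m%n+[m/n]*n; m%n<n)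
open import Data.Nat.Primality using (Prime; ¬prime[1]; prime⇒irreducible; prime⇒nonZero)
open import Data.Nat.Coprimality using (Coprime; coprime-Bézout; coprime-divisor)
open import Data.Nat.GCD using (module Bézout)
open import Data.Parity using (Parity; 0ℙ; 1ℙ)
import Data.Parity as ℙ
open import Data.Parity.Properties using (+-homo-+; *-homo-*)
  renaming (_≟_ to _≟ℙ_; +-comm to ℙ-+-comm; +-identityʳ to ℙ-+-identityʳ; *-identityʳ to ℙ-*-identityʳ; *-zeroʳ to ℙ-*-zeroʳ)
open import Data.Fin using (Fin; toℕ; fromℕ<)
  renaming (_≟_ to _≟ᶠ_)
open import Data.Fin.Properties using (any?; toℕ-fromℕ<)
open import Data.Fin.Permutation using (Permutation′; _⟨$⟩ʳ_; _⟨$⟩ˡ_; _≈_; id; flip; _∘ₚ_; inverseˡ; inverseʳ)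
open import Data.Product using (_×_; _,_; proj₁; proj₂; ∃; ∃-syntax)
open import Data.Sum using (inj₁; inj₂)
open import Data.Unit using (⊤; tt)
open import Data.Empty using (⊥; ⊥-elim)
open import Relation.Nullary using (¬_; Dec; yes; no)
open import Relation.Nullary.Decidable using (map′; _×-dec_)
open import Relation.Unary using (Pred; Decidable)
open import Relation.Binary.Core using (Rel)
open import Relation.Binary.Definitions using (Symmetric)
open import Relation.Binary.PropositionalEquality
  using (_≡_; refl; sym; trans; cong; cong₂; subst; subst₂; module ≡-Reasoning)
open import Relation.Binary.Construct.Closure.ReflexiveTransitive using (Star; ε; _◅_; _◅◅_; gmap; reverse)

open import Defs hiding (sym)

open ≡-Reasoning

2∣⇒parity≡0ℙ : ∀ {m} → 2 ∣ m → parity m ≡ 0ℙ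
2∣⇒parity≡0ℙ (divides q refl) = trans (*-homo-* q 2) (ℙ-*-zeroʳ (parity q))

parity≡0ℙ⇒2∣ : ∀ m → parity m ≡ 0ℙ → 2 ∣ m
parity≡0ℙ⇒2∣ zero          _  = 2 ∣0
parity≡0ℙ⇒2∣ (suc (suc m)) eq = ∣m∣n⇒∣m+n ∣-refl (parity≡0ℙ⇒2∣ m eq)

parity≡1ℙ⇒¬2∣ : ∀ {m} → parity m ≡ 1ℙ → ¬ 2 ∣ m
parity≡1ℙ⇒¬2∣ odd 2∣m with trans (sym odd) (2∣⇒parity≡0ℙ 2∣m)
... | ()

¬2∣⇒parity≡1ℙ : ∀ {m} → ¬ 2 ∣ m → parity m ≡ 1ℙ
¬2∣⇒parity≡1ℙ {m} 2∤m with parity m in eq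
... | 1ℙ = refl
... | 0ℙ = ⊥-elim (2∤m (parity≡0ℙ⇒2∣ m eq))

parity-% : ∀ {N m} .{{_ : NonZero N}} → 2 ∣ N → parity (m % N) ≡ parity m
parity-% {N} {m} 2∣N = sym (begin
  parity m                               ≡⟨ cong parity (m≡m%n+[m/n]*n m N) ⟩
  parity (m % N + m / N * N)             ≡⟨ +-homo-+ (m % N) (m / N * N) ⟩
  parity (m % N) ℙ.+ parity (m / N * N)  ≡⟨ cong (parity (m % N) ℙ.+_) (2∣⇒parity≡0ℙ (∣n⇒∣m*n (m / N) 2∣N)) ⟩
  parity (m % N) ℙ.+ 0ℙ                  ≡⟨ ℙ-+-identityʳ (parity (m % N)) ⟩
  parity (m % N)                         ∎)

x+y≡0ℙ⇒x≡y : ∀ x y → x ℙ.+ y ≡ 0ℙ → x ≡ y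
x+y≡0ℙ⇒x≡y 0ℙ 0ℙ _ = refl
x+y≡0ℙ⇒x≡y 1ℙ 1ℙ _ = refl

x+y+x+y≡0ℙ : ∀ x y → x ℙ.+ y ℙ.+ x ℙ.+ y ≡ 0ℙ
x+y+x+y≡0ℙ 0ℙ 0ℙ = refl
x+y+x+y≡0ℙ 0ℙ 1ℙ = refl
x+y+x+y≡0ℙ 1ℙ 0ℙ = refl
x+y+x+y≡0ℙ 1ℙ 1ℙ = refl

coprime-^ : ∀ {p a} → Prime p → ¬ p ∣ a → ∀ k → Coprime a (p ^ k)
coprime-^ _       _   zero    (_ , d∣1)        = ∣1⇒≡1 d∣1
coprime-^ {p} {a} p-prime p∤a (suc k) {d} (d∣a , d∣p*pᵏ) =
  coprime-^ p-prime p∤a k (d∣a , coprime-divisor d⊥p d∣p*pᵏ)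
  where
  d⊥p : Coprime d p
  d⊥p (e∣d , e∣p) with prime⇒irreducible p-prime e∣p
  ... | inj₁ e≡1  = e≡1
  ... | inj₂ refl = ⊥-elim (p∤a (∣-trans e∣d d∣a))

pred-coprime : ∀ N .{{_ : NonZero N}} → Coprime (N ∸ 1) N
pred-coprime N {d} (d∣N∸1 , d∣N) =
  ∣1⇒≡1 (∣m+n∣m⇒∣n (subst (d ∣_) (trans (sym (suc-pred N)) (+-comm 1 (N ∸ 1))) d∣N) d∣N∸1)

coprime-even⇒parity≡1ℙ : ∀ {u N} → 2 ∣ N → Coprime u N → parity u ≡ 1ℙ
coprime-even⇒parity≡1ℙ 2∣N u⊥N = ¬2∣⇒parity≡1ℙ λ 2∣u → 1+n≢n (u⊥N (2∣u , 2∣N))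

∣-resp-% : ∀ {d m m′ N} .{{_ : NonZero N}} → d ∣ N → m % N ≡ m′ % N → d ∣ m → d ∣ m′
∣-resp-% {d} {m} {m′} {N} d∣N m≡m′ d∣m = subst (d ∣_) (sym (m≡m%n+[m/n]*n m′ N))
  (∣m∣n⇒∣m+n (subst (d ∣_) m≡m′ (%-presˡ-∣ d∣m d∣N)) (∣n⇒∣m*n (m′ / N) d∣N))

conjugate : ∀ {n} → Permutation′ n → Permutation′ n → Permutation′ n
conjugate g σ = (flip g ∘ₚ σ) ∘ₚ g

module _ {n} {X : Graph n} (G : AutGroup X) where

  G′⊆G : ∀ {σ} → σ ∈Comm[ G ] → mem G σ
  G′⊆G (c-resp σ≈τ σ∈G′) = resp G σ≈τ (G′⊆G σ∈G′)
  G′⊆G c-id               = idG G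
  G′⊆G (c-comm g∈G h∈G)   = mulG G (mulG G (mulG G (invG G g∈G) (invG G h∈G)) g∈G) h∈G
  G′⊆G (c-mul σ∈G′ τ∈G′)  = mulG G (G′⊆G σ∈G′) (G′⊆G τ∈G′)
  G′⊆G (c-inv σ∈G′)       = invG G (G′⊆G σ∈G′)

  InducedEdge-sym : ∀ {x} → Symmetric (InducedEdge X G x)
  InducedEdge-sym (ind-edge y∈ z∈ e) = ind-edge z∈ y∈ (Graph.sym X e)

  G′-normal : ∀ {g σ} → mem G g → σ ∈Comm[ G ] → conjugate g σ ∈Comm[ G ]
  G′-normal {g} g∈G (c-resp σ≈τ σ∈G′) =
    c-resp (λ z → cong (g ⟨$⟩ʳ_) (σ≈τ (g ⟨$⟩ˡ z))) (G′-normal g∈G σ∈G′)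
  G′-normal {g} g∈G c-id =
    c-resp (λ _ → sym (inverseʳ g)) c-id
  G′-normal {g} g∈G (c-comm {g = a} {h = b} a∈G b∈G) =
    -- [g a g⁻¹, g b g⁻¹] = g [a, b] g⁻¹, cancelling g⁻¹ g three times
    c-resp (λ _ → cong (λ x → g ⟨$⟩ʳ (b ⟨$⟩ʳ x))
                    (trans (inverseˡ g) (cong (a ⟨$⟩ʳ_) (trans (inverseˡ g) (cong (b ⟨$⟩ˡ_) (inverseˡ g))))))
      (c-comm (conj∈G a∈G) (conj∈G b∈G))
    where
    conj∈G : ∀ {σ} → mem G σ → mem G (conjugate g σ)
    conj∈G σ∈G = mulG G (mulG G (invG G g∈G) σ∈G) g∈G
  G′-normal {g} g∈G (c-mul {τ = τ} σ∈G′ τ∈G′) =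
    c-resp (λ _ → cong (λ x → g ⟨$⟩ʳ (τ ⟨$⟩ʳ x)) (inverseˡ g)) (c-mul (G′-normal g∈G σ∈G′) (G′-normal g∈G τ∈G′))
  G′-normal g∈G (c-inv σ∈G′) =
    c-resp (λ _ → refl) (c-inv (G′-normal g∈G σ∈G′))

module Powers {n} (c : Permutation′ n) where

  c^_·_ : ℕ → Fin n → Fin n
  c^ t · z = (c ^ₚ t) ⟨$⟩ʳ z

  c^-suc : ∀ t z → c^ suc t · z ≡ c ⟨$⟩ʳ (c^ t · z)
  c^-suc zero    z = refl
  c^-suc (suc t) z = c^-suc t (c ⟨$⟩ʳ z)

  c^-+ : ∀ a b z → c^ (a + b) · z ≡ c^ a · (c^ b · z)
  c^-+ zero    b z = refl
  c^-+ (suc a) b z = trans (c^-+ a b (c ⟨$⟩ʳ z)) (cong (c^ a ·_) (c^-suc b z))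

  c^-comm : ∀ a b z → c^ a · (c^ b · z) ≡ c^ b · (c^ a · z)
  c^-comm a b z = trans (sym (c^-+ a b z)) (trans (cong (c^_· z) (+-comm a b)) (c^-+ b a z))

module CyclicCommutator {n} {X : Graph n} (G : AutGroup X) {N : ℕ} .{{_ : NonZero N}} {c : Permutation′ n}
  (c∈G′ : c ∈Comm[ G ])
  (G′⊆⟨c⟩ : ∀ σ → σ ∈Comm[ G ] → ∃[ i ] (i < N × σ ≈ (c ^ₚ i)))
  (c^-injective : ∀ i j → i < N → j < N → (c ^ₚ i) ≈ (c ^ₚ j) → i ≡ j)
  where

  open Powers c public

  c^∈G′ : ∀ t → (c ^ₚ t) ∈Comm[ G ]
  c^∈G′ zero    = c-id
  c^∈G′ (suc t) = c-mul c∈G′ (c^∈G′ t)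

  c^∈G : ∀ t → mem G (c ^ₚ t)
  c^∈G t = G′⊆G G (c^∈G′ t)

  c^-edge : ∀ t {u v} → E X u v → E X (c^ t · u) (c^ t · v)
  c^-edge t {u} {v} = proj₁ (aut G (c^∈G t) u v)

  c^-N : ∀ z → c^ N · z ≡ z
  c^-N z with G′⊆⟨c⟩ (c ^ₚ N) (c^∈G′ N)
  ... | zero  , _     , c^N≈id  = c^N≈id z
  ... | suc i , 1+i<N , c^N≈c^i =
    ⊥-elim (<⇒≱ 1+i<N (m∸n≡0⇒m≤n (c^-injective (N ∸ suc i) 0 (∸-monoʳ-< (s≤s z≤n) (<⇒≤ 1+i<N)) (>-nonZero⁻¹ N) c^[N∸i]≈id)))
    where
    c^[N∸i]≈id : ∀ w → c^ (N ∸ suc i) · w ≡ w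
    c^[N∸i]≈id w = begin
      c^ (N ∸ suc i) · w                     ≡⟨ cong (c^ (N ∸ suc i) ·_) (sym (inverseʳ (c ^ₚ suc i))) ⟩
      c^ (N ∸ suc i) · (c^ suc i · w′)       ≡⟨ sym (c^-+ (N ∸ suc i) (suc i) w′) ⟩
      c^ (N ∸ suc i + suc i) · w′            ≡⟨ cong (c^_· w′) (m∸n+n≡m (<⇒≤ 1+i<N)) ⟩
      c^ N · w′                              ≡⟨ c^N≈c^i w′ ⟩
      c^ suc i · w′                          ≡⟨ inverseʳ (c ^ₚ suc i) ⟩
      w                                      ∎
      where w′ = (c ^ₚ suc i) ⟨$⟩ˡ w

  c^-*N : ∀ q z → c^ (q * N) · z ≡ z
  c^-*N zero    z = refl
  c^-*N (suc q) z = trans (c^-+ N (q * N) z) (trans (cong (c^ N ·_) (c^-*N q z)) (c^-N z))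

  c^-% : ∀ m z → c^ (m % N) · z ≡ c^ m · z
  c^-% m z = begin
    c^ (m % N) · z                     ≡⟨ cong (c^ (m % N) ·_) (sym (c^-*N (m / N) z)) ⟩
    c^ (m % N) · (c^ (m / N * N) · z)  ≡⟨ sym (c^-+ (m % N) (m / N * N) z) ⟩
    c^ (m % N + m / N * N) · z         ≡⟨ cong (c^_· z) (sym (m≡m%n+[m/n]*n m N)) ⟩
    c^ m · z                           ∎

  c^-cancel : ∀ j t z → c^ (j + t * (N ∸ 1)) · (c^ t · z) ≡ c^ j · z
  c^-cancel j t z = begin
    c^ (j + t * (N ∸ 1)) · (c^ t · z)  ≡⟨ sym (c^-+ (j + t * (N ∸ 1)) t z) ⟩
    c^ (j + t * (N ∸ 1) + t) · z       ≡⟨ cong (c^_· z) (trans (+-assoc j _ t) (cong (j +_) t[N∸1]+t≡tN)) ⟩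
    c^ (j + t * N) · z                 ≡⟨ c^-+ j (t * N) z ⟩
    c^ j · (c^ (t * N) · z)            ≡⟨ cong (c^ j ·_) (c^-*N t z) ⟩
    c^ j · z                           ∎
    where
    t[N∸1]+t≡tN : t * (N ∸ 1) + t ≡ t * N
    t[N∸1]+t≡tN = trans (+-comm _ t) (trans (sym (*-suc t (N ∸ 1))) (cong (t *_) (suc-pred N)))

  conjExp : ∀ g → mem G g → ℕ
  conjExp g g∈G = proj₁ (G′⊆⟨c⟩ (conjugate g c) (G′-normal G g∈G c∈G′))

  c-conj : ∀ g (g∈G : mem G g) w → g ⟨$⟩ʳ (c ⟨$⟩ʳ w) ≡ c^ conjExp g g∈G · (g ⟨$⟩ʳ w)
  c-conj g g∈G w =
    trans (cong (λ x → g ⟨$⟩ʳ (c ⟨$⟩ʳ x)) (sym (inverseˡ g)))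
          (proj₂ (proj₂ (G′⊆⟨c⟩ (conjugate g c) (G′-normal G g∈G c∈G′))) (g ⟨$⟩ʳ w))

  c^-conj : ∀ g (g∈G : mem G g) t w → g ⟨$⟩ʳ (c^ t · w) ≡ c^ (t * conjExp g g∈G) · (g ⟨$⟩ʳ w)
  c^-conj g g∈G zero    w = refl
  c^-conj g g∈G (suc t) w = begin
    g ⟨$⟩ʳ (c^ suc t · w)                ≡⟨ cong (g ⟨$⟩ʳ_) (c^-suc t w) ⟩
    g ⟨$⟩ʳ (c ⟨$⟩ʳ (c^ t · w))           ≡⟨ c-conj g g∈G (c^ t · w) ⟩
    c^ u · (g ⟨$⟩ʳ (c^ t · w))           ≡⟨ cong (c^ u ·_) (c^-conj g g∈G t w) ⟩
    c^ u · (c^ (t * u) · (g ⟨$⟩ʳ w))     ≡⟨ sym (c^-+ u (t * u) (g ⟨$⟩ʳ w)) ⟩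
    c^ (u + t * u) · (g ⟨$⟩ʳ w)          ∎
    where u = conjExp g g∈G

  c^-conj-inverse : ∀ g (g∈G : mem G g) t w →
    c^ (t * conjExp (flip g) (invG G g∈G) * conjExp g g∈G) · w ≡ c^ t · w
  c^-conj-inverse g g∈G t w = sym (begin
    c^ t · w                                     ≡⟨ sym (inverseʳ g) ⟩
    g ⟨$⟩ʳ (g ⟨$⟩ˡ (c^ t · w))                   ≡⟨ cong (g ⟨$⟩ʳ_) (c^-conj (flip g) (invG G g∈G) t w) ⟩
    g ⟨$⟩ʳ (c^ (t * u′) · (g ⟨$⟩ˡ w))            ≡⟨ c^-conj g g∈G (t * u′) (g ⟨$⟩ˡ w) ⟩
    c^ (t * u′ * u) · (g ⟨$⟩ʳ (g ⟨$⟩ˡ w))        ≡⟨ cong (c^ (t * u′ * u) ·_) (inverseʳ g) ⟩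
    c^ (t * u′ * u) · w                          ∎)
    where
    u  = conjExp g g∈G
    u′ = conjExp (flip g) (invG G g∈G)

  conjExp-coprime : ∀ g (g∈G : mem G g) → Coprime (conjExp g g∈G) N
  conjExp-coprime g g∈G {d} (d∣u , d∣N) = ∣1⇒≡1 (∣-resp-% d∣N u′u≡1 (∣n⇒∣m*n (1 * u′) d∣u))
    where
    u′ = conjExp (flip g) (invG G g∈G)
    u′u≡1 : (1 * u′ * conjExp g g∈G) % N ≡ 1 % N
    u′u≡1 = c^-injective _ _ (m%n<n _ N) (m%n<n 1 N) λ w →
      trans (c^-% _ w) (trans (c^-conj-inverse g g∈G 1 w) (sym (c^-% 1 w)))

  c^∈Orbit : ∀ t {x w} → InOrbit G x w → InOrbit G x (c^ t · w)
  c^∈Orbit t (σ , σ∈G′ , σx≡w) = σ ∘ₚ (c ^ₚ t) , c-mul σ∈G′ (c^∈G′ t) , cong (c^ t ·_) σx≡w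

  Orbit⇒c^ : ∀ {x y} → InOrbit G x y → ∃[ t ] (c^ t · x ≡ y)
  Orbit⇒c^ {x} (σ , σ∈G′ , σx≡y) with G′⊆⟨c⟩ σ σ∈G′
  ... | t , _ , σ≈c^t = t , trans (sym (σ≈c^t x)) σx≡y

  Orbit-shift : ∀ {x y z} → InOrbit G x y → InOrbit G x z → ∃[ t ] (c^ t · y ≡ z)
  Orbit-shift {x} y∈ z∈ with Orbit⇒c^ y∈ | Orbit⇒c^ z∈
  ... | a , refl | b , refl = b + a * (N ∸ 1) , c^-cancel b a x

  module _ {ℓ ℓ′} {S : Rel (Fin n) ℓ} (S-sym : Symmetric S)
    {Q : Pred (Fin n) ℓ′} (Q-c : ∀ {w} → Q w → Q (c ⟨$⟩ʳ w)) {a : ℕ}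
    (a-walk : ∀ {w} → Q w → Star S w (c^ a · w)) where

    private
      Q-c^ : ∀ t {w} → Q w → Q (c^ t · w)
      Q-c^ zero    q = q
      Q-c^ (suc t) {w} q = subst Q (sym (c^-suc t w)) (Q-c (Q-c^ t q))

      *a-walk : ∀ m {w} → Q w → Star S w (c^ (m * a) · w)
      *a-walk zero    q = ε
      *a-walk (suc m) {w} q =
        subst (Star S w) (sym (c^-+ a (m * a) w)) (*a-walk m q ◅◅ a-walk (Q-c^ (m * a) q))

      c-walk : Coprime a N → ∀ {w} → Q w → Star S w (c ⟨$⟩ʳ w)
      c-walk a⊥N {w} q with coprime-Bézout a⊥N
      ... | Bézout.+- x y 1+yN≡xa = subst (Star S w) c^xa·w≡c·w (*a-walk x q)
        where
        c^xa·w≡c·w : c^ (x * a) · w ≡ c ⟨$⟩ʳ w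
        c^xa·w≡c·w = trans (cong (c^_· w) (sym 1+yN≡xa)) (trans (c^-+ 1 (y * N) w) (cong (c^ 1 ·_) (c^-*N y w)))
      ... | Bézout.-+ x y 1+xa≡yN = reverse S-sym (subst (Star S (c ⟨$⟩ʳ w)) c^xa·cw≡w (*a-walk x (Q-c q)))
        where
        c^xa·cw≡w : c^ (x * a) · (c ⟨$⟩ʳ w) ≡ w
        c^xa·cw≡w = trans (sym (c^-+ (x * a) 1 w))
                      (trans (cong (c^_· w) (trans (+-comm (x * a) 1) 1+xa≡yN)) (c^-*N y w))

    c^-walk : Coprime a N → ∀ t {w} → Q w → Star S w (c^ t · w)
    c^-walk a⊥N zero    q = ε
    c^-walk a⊥N (suc t) {w} q =
      c^-walk a⊥N t q ◅◅ subst (Star S _) (sym (c^-suc t w)) (c-walk a⊥N (Q-c^ t q))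

  module ShiftFree (X-connected : Connected X) (G-transitive : Transitive G) (G-minimal : GMinimal X G)
    (x₀ : Fin n) (P : Pred ℕ 0ℓ) (P? : Decidable P)
    (P-% : ∀ {t} → P t → P (t % N)) (P-unit : ∀ {t u} → Coprime u N → P t → P (t * u)) where

    -- P-unit is what makes Shifted symmetric (u = N ∸ 1) and G-invariant (u = conjExp g).

    Shifted : Rel (Fin n) 0ℓ
    Shifted u v = ∃[ t ] (P t × c^ t · u ≡ v)

    Shifted? : ∀ u v → Dec (Shifted u v)
    Shifted? u v = map′ fromFin toFin (any? λ t → P? (toℕ t) ×-dec (c^ toℕ t · u ≟ᶠ v))
      where
      fromFin : ∃[ t ] (P (toℕ t) × c^ toℕ t · u ≡ v) → Shifted u v
      fromFin (t , Pt , c^tu≡v) = toℕ t , Pt , c^tu≡v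
      toFin : Shifted u v → ∃[ t ] (P (toℕ t) × c^ toℕ t · u ≡ v)
      toFin (t , Pt , c^tu≡v) = fromℕ< (m%n<n t N) ,
        subst P (sym t%N≡) (P-% Pt) , trans (cong (c^_· u) t%N≡) (trans (c^-% t u) c^tu≡v)
        where t%N≡ = toℕ-fromℕ< (m%n<n t N)

    Shifted-sym : Symmetric Shifted
    Shifted-sym {u} (t , Pt , refl) = t * (N ∸ 1) , P-unit (pred-coprime N) Pt , c^-cancel 0 t u

    Shifted-map : ∀ {g u v} (g∈G : mem G g) → Shifted u v → Shifted (g ⟨$⟩ʳ u) (g ⟨$⟩ʳ v)
    Shifted-map {g} {u} g∈G (t , Pt , refl) =
      t * conjExp g g∈G , P-unit (conjExp-coprime g g∈G) Pt , sym (c^-conj g g∈G t u)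

    Shifted-unmap : ∀ {g u v} (g∈G : mem G g) → Shifted (g ⟨$⟩ʳ u) (g ⟨$⟩ʳ v) → Shifted u v
    Shifted-unmap {g} g∈G s = subst₂ Shifted (inverseˡ g) (inverseˡ g) (Shifted-map (invG G g∈G) s)

    Y : Graph n
    Y = record
      { E      = λ u v → E X u v × ¬ Shifted u v
      ; sym    = λ (e , ¬s) → Graph.sym X e , ¬s ∘ Shifted-sym
      ; irrefl = irrefl X ∘ proj₁
      }

    Y-map : ∀ {g u v} (g∈G : mem G g) → E Y u v → E Y (g ⟨$⟩ʳ u) (g ⟨$⟩ʳ v)
    Y-map {u = u} {v} g∈G (e , ¬s) = proj₁ (aut G g∈G u v) e , ¬s ∘ Shifted-unmap g∈G

    Y-unmap : ∀ {g u v} (g∈G : mem G g) → E Y (g ⟨$⟩ʳ u) (g ⟨$⟩ʳ v) → E Y u v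
    Y-unmap {u = u} {v} g∈G (e , ¬s) = proj₂ (aut G g∈G u v) e , ¬s ∘ Shifted-map g∈G

    Y-connected⇒unshifted : Connected Y → ∀ {u v} → E X u v → ¬ Shifted u v
    Y-connected⇒unshifted Y-connected {u} {v} e =
      proj₂ (G-minimal Y (λ _ _ → proj₁) Y-connected (λ _ g∈G _ _ → Y-map g∈G , Y-unmap g∈G) u v e)

    infix 4 _⇝_
    _⇝_ : Rel (Fin n) 0ℓ
    _⇝_ = Star (E Y)

    ⇝-map : ∀ {g u v} → mem G g → u ⇝ v → g ⟨$⟩ʳ u ⇝ g ⟨$⟩ʳ v
    ⇝-map {g} g∈G = gmap (g ⟨$⟩ʳ_) (Y-map g∈G)

    ⇝-reverse : ∀ {u v} → u ⇝ v → v ⇝ u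
    ⇝-reverse = reverse (Graph.sym Y)

    reach-orbit : ∀ {d} → (∀ {t} → P t → d ∣ t) → ∀ z → ∃[ j ] (d ∣ j × x₀ ⇝ c^ j · z)
    reach-orbit {d} P⇒d∣ z = along (X-connected x₀ z) (0 , d ∣0 , ε)
      where
      Reached : Pred (Fin n) 0ℓ
      Reached z = ∃[ j ] (d ∣ j × x₀ ⇝ c^ j · z)

      -- a deleted edge a — c^t a is absorbed into the exponent; any other edge is moved into Y by c^j
      step : ∀ {a b} → E X a b → Reached a → Reached b
      step {a} {b} e (j , d∣j , walk) with Shifted? a b
      ... | yes (t , Pt , refl) =
        j + t * (N ∸ 1) , ∣m∣n⇒∣m+n d∣j (∣m⇒∣m*n (N ∸ 1) (P⇒d∣ Pt)) , subst (x₀ ⇝_) (sym (c^-cancel j t a)) walk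
      ... | no ¬s = j , d∣j , walk ◅◅ Y-map (c^∈G j) (e , ¬s) ◅ ε

      along : ∀ {a b} → Star (E X) a b → Reached a → Reached b
      along ε        r = r
      along (e ◅ es) r = along es (step e r)

    private
      *-x₀-walk : ∀ {a} → x₀ ⇝ c^ a · x₀ → ∀ m → x₀ ⇝ c^ (m * a) · x₀
      *-x₀-walk         walk zero    = ε
      *-x₀-walk {a} walk (suc m) = *-x₀-walk {a} walk m ◅◅
        subst (c^ (m * a) · x₀ ⇝_) (sym (trans (c^-+ a (m * a) x₀) (c^-comm a (m * a) x₀))) (⇝-map (c^∈G (m * a)) walk)

    ⇝-c^-everywhere : ∀ {a} → x₀ ⇝ c^ a · x₀ → ∀ w → w ⇝ c^ a · w
    ⇝-c^-everywhere {a} walk w with G-transitive x₀ w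
    ... | g , g∈G , refl = subst (_ ⇝_) g·c^[u′a]x₀≡c^a·gx₀ (⇝-map g∈G (*-x₀-walk walk u′))
      where
      u′ = conjExp (flip g) (invG G g∈G)
      g·c^[u′a]x₀≡c^a·gx₀ : g ⟨$⟩ʳ (c^ (u′ * a) · x₀) ≡ c^ a · (g ⟨$⟩ʳ x₀)
      g·c^[u′a]x₀≡c^a·gx₀ = begin
        g ⟨$⟩ʳ (c^ (u′ * a) · x₀)                 ≡⟨ cong (λ m → g ⟨$⟩ʳ (c^ m · x₀)) (*-comm u′ a) ⟩
        g ⟨$⟩ʳ (c^ (a * u′) · x₀)                 ≡⟨ cong (λ x → g ⟨$⟩ʳ (c^ (a * u′) · x)) (sym (inverseˡ g)) ⟩
        g ⟨$⟩ʳ (c^ (a * u′) · (g ⟨$⟩ˡ (g ⟨$⟩ʳ x₀))) ≡⟨ cong (g ⟨$⟩ʳ_) (sym (c^-conj (flip g) (invG G g∈G) a (g ⟨$⟩ʳ x₀))) ⟩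
        g ⟨$⟩ʳ (g ⟨$⟩ˡ (c^ a · (g ⟨$⟩ʳ x₀)))       ≡⟨ inverseʳ g ⟩
        c^ a · (g ⟨$⟩ʳ x₀)                        ∎

    Y-connected : ∀ {a} → Coprime a N → x₀ ⇝ c^ a · x₀ → Connected Y
    Y-connected {a} a⊥N walk u v = ⇝-reverse (from-x₀ u) ◅◅ from-x₀ v
      where
      from-x₀ : ∀ z → x₀ ⇝ z
      from-x₀ z with reach-orbit (λ _ → 1∣ _) z
      ... | j , _ , x₀⇝c^jz = x₀⇝c^jz ◅◅ ⇝-reverse
        (c^-walk (Graph.sym Y) {Q = λ _ → ⊤} (λ _ → tt) (λ {w} _ → ⇝-c^-everywhere {a} walk w) a⊥N j tt)

module PrimePowerCommutator {n} {X : Graph n} (X-connected : Connected X) {G : AutGroup X}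
  (G-transitive : Transitive G) (G-minimal : GMinimal X G)
  {p k : ℕ} (p-prime : Prime p) {c : Permutation′ n}
  (c∈G′ : c ∈Comm[ G ])
  (G′⊆⟨c⟩ : ∀ σ → σ ∈Comm[ G ] → ∃[ i ] (i < p ^ suc k × σ ≈ (c ^ₚ i)))
  (c^-injective : ∀ i j → i < p ^ suc k → j < p ^ suc k → (c ^ₚ i) ≈ (c ^ₚ j) → i ≡ j)
  (x₀ : Fin n) where

  private
    N : ℕ
    N = p ^ suc k

    instance
      p≢0 : NonZero p
      p≢0 = prime⇒nonZero p-prime
      N≢0 : NonZero N
      N≢0 = m^n≢0 p (suc k)

  open CyclicCommutator G c∈G′ G′⊆⟨c⟩ c^-injective

  private
    p∣N : p ∣ N
    p∣N = m∣m*n (p ^ k)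

  module ⟨cᵖ⟩ = ShiftFree X-connected G-transitive G-minimal x₀
    (p ∣_) (p ∣?_) (λ p∣t → %-presˡ-∣ p∣t p∣N) (λ _ → ∣m⇒∣m*n _)

  X-edges-unshifted : ∀ {u v} → E X u v → ¬ ⟨cᵖ⟩.Shifted u v
  X-edges-unshifted with ⟨cᵖ⟩.reach-orbit (λ p∣t → p∣t) (c ⟨$⟩ʳ x₀)
  ... | j , p∣j , walk = ⟨cᵖ⟩.Y-connected⇒unshifted
    (⟨cᵖ⟩.Y-connected (coprime-^ p-prime p∤j+1 (suc k)) (subst (x₀ ⟨cᵖ⟩.⇝_) (sym (c^-+ j 1 x₀)) walk))
    where
    p∤j+1 : ¬ p ∣ j + 1
    p∤j+1 p∣j+1 = ¬prime[1] (subst Prime (∣1⇒≡1 (∣m+n∣m⇒∣n p∣j+1 p∣j)) p-prime)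

  orbit-edge-shift : ∀ {x} → OrbitHasEdge X G x →
    ∃[ t ] (¬ p ∣ t × ∀ {w} → InOrbit G x w → E X w (c^ t · w))
  orbit-edge-shift {x} (y , z , ind-edge y∈ z∈ e) with Orbit-shift y∈ z∈
  ... | t , refl = t , (λ p∣t → X-edges-unshifted e (t , p∣t , refl)) , edge-at
    where
    edge-at : ∀ {w} → InOrbit G x w → E X w (c^ t · w)
    edge-at w∈ with Orbit-shift y∈ w∈
    ... | s , refl = subst (E X (c^ s · y)) (c^-comm s t y) (c^-edge s e)

  orbit-connected : ∀ {x} → OrbitHasEdge X G x → OrbitConnected X G x
  orbit-connected {x} has-edge y z y∈ z∈ with orbit-edge-shift has-edge | Orbit-shift y∈ z∈
  ... | t , p∤t , edge-at | s , refl =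
    c^-walk (InducedEdge-sym G) {Q = InOrbit G x} (c^∈Orbit 1)
      (λ w∈ → ind-edge w∈ (c^∈Orbit t w∈) (edge-at w∈) ◅ ε) (coprime-^ p-prime p∤t (suc k)) s y∈

  module _ (has-edge : OrbitHasEdge X G x₀) (2∣p : 2 ∣ p) where

    private
      2∣N : 2 ∣ N
      2∣N = ∣m⇒∣m*n (p ^ k) 2∣p

      p≡2 : p ≡ 2
      p≡2 with prime⇒irreducible p-prime 2∣p
      ... | inj₁ ()
      ... | inj₂ 2≡p = sym 2≡p

      parity-*unit : ∀ m {u} → Coprime u N → parity (m * u) ≡ parity m
      parity-*unit m u⊥N = trans (*-homo-* m _)
        (trans (cong (parity m ℙ.*_) (coprime-even⇒parity≡1ℙ 2∣N u⊥N)) (ℙ-*-identityʳ (parity m)))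

      parity-+*unit : ∀ a b {u} → Coprime u N → parity (a + b * u) ≡ parity a ℙ.+ parity b
      parity-+*unit a b u⊥N = trans (+-homo-+ a _) (cong (parity a ℙ.+_) (parity-*unit b u⊥N))

    open ShiftFree X-connected G-transitive G-minimal x₀
      (λ t → parity t ≡ 1ℙ) (λ t → parity t ≟ℙ 1ℙ) (λ odd → trans (parity-% 2∣N) odd)
      (λ {t} u⊥N odd → trans (parity-*unit t u⊥N) odd)

    Y-disconnected : ¬ Connected Y
    Y-disconnected Y-conn with orbit-edge-shift has-edge
    ... | t , p∤t , edge-at = Y-connected⇒unshifted Y-conn (edge-at (id , c-id , refl))
      (t , ¬2∣⇒parity≡1ℙ (λ 2∣t → p∤t (subst (_∣ t) (sym p≡2) 2∣t)) , refl)

    x₀-walk-even : ∀ i → x₀ ⇝ c^ i · x₀ → parity i ≡ 0ℙ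
    x₀-walk-even i walk with parity i in odd
    ... | 0ℙ = refl
    ... | 1ℙ = ⊥-elim (Y-disconnected (Y-connected (coprime-^ p-prime p∤i (suc k)) walk))
      where
      p∤i : ¬ p ∣ i
      p∤i p∣i = parity≡1ℙ⇒¬2∣ odd (subst (_∣ i) p≡2 p∣i)

    walk-even : ∀ {w} i → w ⇝ c^ i · w → parity i ≡ 0ℙ
    walk-even {w} i walk with G-transitive x₀ w
    ... | g , g∈G , refl = trans (sym (parity-*unit i (conjExp-coprime (flip g) (invG G g∈G))))
      (x₀-walk-even (i * u′) (subst₂ _⇝_ (inverseˡ g) g⁻¹c^igx₀≡ (⇝-map (invG G g∈G) walk)))
      where
      u′ = conjExp (flip g) (invG G g∈G)
      g⁻¹c^igx₀≡ : g ⟨$⟩ˡ (c^ i · (g ⟨$⟩ʳ x₀)) ≡ c^ (i * u′) · x₀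
      g⁻¹c^igx₀≡ = trans (c^-conj (flip g) (invG G g∈G) i (g ⟨$⟩ʳ x₀)) (cong (c^ (i * u′) ·_) (inverseˡ g))

    record Lands (g : Permutation′ n) (j : ℕ) : Set where
      constructor lands-by
      field walk : x₀ ⇝ c^ j · (g ⟨$⟩ʳ x₀)

    lands : ∀ g → ∃ (Lands g)
    lands g with reach-orbit (λ _ → 1∣ _) (g ⟨$⟩ʳ x₀)
    ... | j , _ , walk = j , lands-by walk

    φ : Permutation′ n → Parity
    φ g = parity (proj₁ (lands g))

    φ-spec : ∀ {g j} → Lands g j → φ g ≡ parity j
    φ-spec {g} {j} (lands-by walk) = x+y≡0ℙ⇒x≡y (parity j′) (parity j)
      (trans (sym (parity-+*unit j′ j (pred-coprime N)))
        (walk-even (j′ + j * (N ∸ 1)) (⇝-reverse walk ◅◅ subst (x₀ ⇝_) (sym (c^-cancel j′ j _)) walk′)))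
      where
      j′    = proj₁ (lands g)
      walk′ = Lands.walk (proj₂ (lands g))

    φ-resp : ∀ σ τ → σ ≈ τ → φ σ ≡ φ τ
    φ-resp σ τ σ≈τ =
      sym (φ-spec {τ} {proj₁ (lands σ)} (lands-by (subst (λ v → x₀ ⇝ c^ proj₁ (lands σ) · v) (σ≈τ x₀) (Lands.walk (proj₂ (lands σ))))))

    Lands-∘ : ∀ {σ τ j j′} (τ∈G : mem G τ) → Lands σ j → Lands τ j′ → Lands (σ ∘ₚ τ) (j′ + j * conjExp τ τ∈G)
    Lands-∘ {σ} {τ} {j} {j′} τ∈G (lands-by σ-walk) (lands-by τ-walk) = lands-by (τ-walk ◅◅
      subst (c^ j′ · (τ ⟨$⟩ʳ x₀) ⇝_) (trans (cong (c^ j′ ·_) (c^-conj τ τ∈G j (σ ⟨$⟩ʳ x₀))) (sym (c^-+ j′ _ _)))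
        (⇝-map (c^∈G j′) (⇝-map τ∈G σ-walk)))

    Lands-flip : ∀ {g j} (g∈G : mem G g) → Lands g j → Lands (flip g) (j * conjExp (flip g) (invG G g∈G) * (N ∸ 1))
    Lands-flip {g} {j} g∈G (lands-by walk) = lands-by (subst (_⇝ c^ m · (g ⟨$⟩ˡ x₀)) (c^-cancel 0 (j * u′) x₀)
      (⇝-map (c^∈G m) (⇝-reverse (subst (g ⟨$⟩ˡ x₀ ⇝_) g⁻¹c^jgx₀≡ (⇝-map (invG G g∈G) walk)))))
      where
      u′ = conjExp (flip g) (invG G g∈G)
      m  = j * u′ * (N ∸ 1)
      g⁻¹c^jgx₀≡ : g ⟨$⟩ˡ (c^ j · (g ⟨$⟩ʳ x₀)) ≡ c^ (j * u′) · x₀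
      g⁻¹c^jgx₀≡ = trans (c^-conj (flip g) (invG G g∈G) j (g ⟨$⟩ʳ x₀)) (cong (c^ (j * u′) ·_) (inverseˡ g))

    φ-∘ : ∀ σ {τ} → mem G τ → φ (σ ∘ₚ τ) ≡ φ σ ℙ.+ φ τ
    φ-∘ σ {τ} τ∈G = trans (φ-spec (Lands-∘ τ∈G (proj₂ (lands σ)) (proj₂ (lands τ))))
      (trans (parity-+*unit (proj₁ (lands τ)) (proj₁ (lands σ)) (conjExp-coprime τ τ∈G)) (ℙ-+-comm (φ τ) (φ σ)))

    φ-flip : ∀ {g} → mem G g → φ (flip g) ≡ φ g
    φ-flip {g} g∈G = trans (φ-spec (Lands-flip g∈G (proj₂ (lands g))))
      (trans (parity-*unit (j * u′) (pred-coprime N)) (parity-*unit j (conjExp-coprime (flip g) (invG G g∈G))))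
      where
      j  = proj₁ (lands g)
      u′ = conjExp (flip g) (invG G g∈G)

    φ-G′ : ∀ {σ} → σ ∈Comm[ G ] → φ σ ≡ 0ℙ
    φ-G′ (c-resp {σ = σ} {τ} σ≈τ σ∈G′) = trans (sym (φ-resp σ τ σ≈τ)) (φ-G′ σ∈G′)
    φ-G′ c-id               = φ-spec {id} {0} (lands-by ε)
    φ-G′ (c-comm {g = g} {h = h} g∈G h∈G) = begin
      φ (((flip g ∘ₚ flip h) ∘ₚ g) ∘ₚ h)          ≡⟨ φ-∘ ((flip g ∘ₚ flip h) ∘ₚ g) h∈G ⟩
      φ ((flip g ∘ₚ flip h) ∘ₚ g) ℙ.+ φ h         ≡⟨ cong (ℙ._+ φ h) (φ-∘ (flip g ∘ₚ flip h) g∈G) ⟩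
      φ (flip g ∘ₚ flip h) ℙ.+ φ g ℙ.+ φ h        ≡⟨ cong (λ x → x ℙ.+ φ g ℙ.+ φ h) (φ-∘ (flip g) (invG G h∈G)) ⟩
      φ (flip g) ℙ.+ φ (flip h) ℙ.+ φ g ℙ.+ φ h  ≡⟨ cong₂ (λ x y → x ℙ.+ y ℙ.+ φ g ℙ.+ φ h) (φ-flip g∈G) (φ-flip h∈G) ⟩
      φ g ℙ.+ φ h ℙ.+ φ g ℙ.+ φ h                ≡⟨ x+y+x+y≡0ℙ (φ g) (φ h) ⟩
      0ℙ                                          ∎
    φ-G′ (c-mul {σ = σ} σ∈G′ τ∈G′) = trans (φ-∘ σ (G′⊆G G τ∈G′)) (cong₂ ℙ._+_ (φ-G′ σ∈G′) (φ-G′ τ∈G′))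
    φ-G′ (c-inv σ∈G′)       = trans (φ-flip (G′⊆G G σ∈G′)) (φ-G′ σ∈G′)

    φ-c : φ c ≡ 1ℙ
    φ-c = trans (φ-spec {c} {N ∸ 1} (lands-by (subst (x₀ ⇝_) (sym (trans (cong (c^_· x₀) (suc-pred N)) (c^-N x₀))) ε)))
      (coprime-even⇒parity≡1ℙ 2∣N (pred-coprime N))

    orbit-edge⇒p-odd : ⊥
    orbit-edge⇒p-odd with trans (sym φ-c) (φ-G′ c∈G′)
    ... | ()

trivial-G′⇒no-orbit-edge : ∀ {n} {X : Graph n} {G : AutGroup X} {c : Permutation′ n} →
  (∀ σ → σ ∈Comm[ G ] → ∃[ i ] (i < 1 × σ ≈ (c ^ₚ i))) → ∀ x → ¬ OrbitHasEdge X G x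
trivial-G′⇒no-orbit-edge {X = X} {G} G′⊆⟨id⟩ x (y , z , ind-edge y∈ z∈ e) =
  irrefl X (subst₂ (E X) (fixed y∈) (fixed z∈) e)
  where
  fixed : ∀ {y} → InOrbit G x y → y ≡ x
  fixed (σ , σ∈G′ , σx≡y) with G′⊆⟨id⟩ σ σ∈G′
  ... | zero  , _       , σ≈id = trans (sym σx≡y) (σ≈id x)
  ... | suc _ , s≤s () , _

lemma4p3 : ∀ {n} (X : Graph n) → Connected X → VertexTransitive X → 3 ≤ n →
    (G : AutGroup X) → Transitive G →
    (p k : ℕ) → Prime p → CommCyclicOfOrder G (p ^ k) →
    GMinimal X G →
    (∀ (x : Fin n) → OrbitHasEdge X G x) →
    (∀ (x : Fin n) → OrbitConnected X G x) × Odd p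
lemma4p3 X _ _ 3≤n G _ p zero _ (_ , _ , G′⊆⟨id⟩ , _) _ has-edge =
  ⊥-elim (trivial-G′⇒no-orbit-edge G′⊆⟨id⟩ x₀ (has-edge x₀))
  where
  x₀ = fromℕ< (≤-trans (s≤s z≤n) 3≤n)
lemma4p3 X X-connected _ 3≤n G G-transitive p (suc k) p-prime (c , c∈G′ , G′⊆⟨c⟩ , c^-injective) G-minimal has-edge =
  (λ x → orbit-connected (has-edge x)) , orbit-edge⇒p-odd (has-edge x₀)
  where
  x₀ = fromℕ< (≤-trans (s≤s z≤n) 3≤n)
  open PrimePowerCommutator X-connected G-transitive G-minimal {k = k} p-prime c∈G′ G′⊆⟨c⟩ c^-injective x₀
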